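{- Let $G$ be a connected graph of order ${\rm n}(G)\ge 2$. The following are equivalent: (i) $\mu_t(G)= {\rm n}(G)-{\rm diam}(G)+1$; (ii) there exists a diametral path $x_0,\dots, x_k$ such that for every pair $u,v$ of vertices of $G$ there exists a shortest path $u=y_0,\dots, y_{k'}=v$ with $\{y_1,\dots, y_{k'-1}\}\subseteq \{x_1,\dots,x_{k-1}\}$.
   Context: All graphs are finite, simple and undirected. ${\rm n}(G)$ is the order and ${\rm diam}(G)$ the diameter of $G$. A diametral path is a shortest path between two vertices at distance ${\rm diam}(G)$. For $X\subseteq V(G)$, two vertices $x,y\in V(G)$ are $X$-visible if there is a shortest $x,y$-path in $G$ none of whose internal vertices lies in $X$. $X$ is a total mutual-visibility set of $G$ if every two vertices of $G$ are $X$-visible; $\mu_t(G)$ is the maximum cardinality of such a set. -}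

module Defs where

open import Data.Nat using (ℕ; zero; suc; _<_; _≤_; _∸_; _+_)
open import Data.Fin using (Fin; toℕ; fromℕ; inject₁)
open import Data.Fin.Subset using (Subset; _∈_; _∉_; ∣_∣)
open import Data.Bool using (Bool; T; not)
open import Data.Product using (Σ; ∃; _×_; _,_)
open import Relation.Binary.PropositionalEquality using (_≡_)
open import Relation.Nullary using (¬_)

record Graph (n : ℕ) : Set where
  field
    adj    : Fin n → Fin n → Bool
    sym    : ∀ u v → adj u v ≡ adj v u
    irrefl : ∀ u → adj u u ≡ Bool.false
open Graph public

Adj : ∀ {n} → Graph n → Fin n → Fin n → Set
Adj G u v = T (adj G u v)

record Walk {n} (G : Graph n) (u v : Fin n) (ℓ : ℕ) : Set where
  field
    vtx    : Fin (suc ℓ) → Fin n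
    start  : vtx Fin.zero ≡ u
    end    : vtx (fromℕ ℓ) ≡ v
    steps  : ∀ (i : Fin ℓ) → Adj G (vtx (inject₁ i)) (vtx (Fin.suc i))
open Walk public

record ShortestPath {n} (G : Graph n) (u v : Fin n) (ℓ : ℕ) : Set where
  field
    walk    : Walk G u v ℓ
    minimal : ∀ ℓ' → Walk G u v ℓ' → ℓ ≤ ℓ'
open ShortestPath public

Internal : ∀ ℓ → Fin (suc ℓ) → Set
Internal ℓ i = (0 < toℕ i) × (toℕ i < ℓ)

Dist : ∀ {n} → Graph n → Fin n → Fin n → ℕ → Set
Dist G u v ℓ = ShortestPath G u v ℓ

Connected : ∀ {n} → Graph n → Set
Connected G = ∀ u v → ∃ λ ℓ → Walk G u v ℓ

IsDiam : ∀ {n} → Graph n → ℕ → Set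
IsDiam {n} G d =
  (Σ (Fin n) λ u → Σ (Fin n) λ v → Dist G u v d) ×
  (∀ u v ℓ → Dist G u v ℓ → ℓ ≤ d)

Visible : ∀ {n} → Graph n → Subset n → Fin n → Fin n → Set
Visible G X x y = Σ ℕ λ ℓ → Σ (ShortestPath G x y ℓ) λ P →
  ∀ i → Internal ℓ i → vtx (walk P) i ∉ X

IsTotalMutualVisibilitySet : ∀ {n} → Graph n → Subset n → Set
IsTotalMutualVisibilitySet G X = ∀ x y → Visible G X x y

IsMuT : ∀ {n} → Graph n → ℕ → Set
IsMuT {n} G m =
  (Σ (Subset n) λ X → IsTotalMutualVisibilitySet G X × ∣ X ∣ ≡ m) ×
  (∀ X → IsTotalMutualVisibilitySet G X → ∣ X ∣ ≤ m)

-- A diametral path x_0,...,x_d (d = diam G): a walk of length d between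
-- two vertices at distance d, i.e. a shortest path of length diam(G).
-- Condition (ii) of Proposition 2.2.
ConditionII : ∀ {n} → Graph n → ℕ → Set
ConditionII {n} G d =
  Σ (Fin n) λ a → Σ (Fin n) λ b → Σ (ShortestPath G a b d) λ X →
    ∀ u v → Σ ℕ λ ℓ → Σ (ShortestPath G u v ℓ) λ Y →
      ∀ j → Internal ℓ j →
        Σ (Fin (suc d)) λ i → Internal d i × (vtx (walk Y) j ≡ vtx (walk X) i)

{-# OPTIONS --safe #-}

-- A shortest path visits pairwise distinct vertices. A total mutual-visibility set X must
-- miss the interior of some diametral path (its ends see each other only along one), so
-- those diam − 1 vertices lie outside X and μ_t ≤ n − diam + 1. If X attains this bound,
-- every vertex outside X lies on that interior, so the shortest paths along which pairs see
-- each other give (ii). Conversely, under (ii) the complement of the interior of the given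
-- diametral path is a total mutual-visibility set of size n − diam + 1.
module Submission where

open import Defs hiding (sym)
open import Data.Nat using (ℕ; zero; suc; pred; _≤_; _<_; _∸_; _+_; z≤n; s≤s; s≤s⁻¹)
open import Data.Nat.Properties
open import Data.Fin as Fin using (Fin; toℕ; inject₁; fromℕ<)
open import Data.Fin.Properties using (toℕ-injective; toℕ-fromℕ; toℕ-fromℕ<; toℕ-inject₁; toℕ<n; any?)
  renaming (_≟_ to _≟ᶠ_)
open import Data.Fin.Subset using (Subset; _∈_; _∉_; ∣_∣; ⊤; ⊥; ∁; _∪_; _-_; ⁅_⁆)
open import Data.Fin.Subset.Properties
  using (∣⊥∣≡0; ∣⊤∣≡n; ∣p∣≤n; ∣∁p∣≡n∸∣p∣; ∣⁅x⁆∣≡1; ∈⊤; x∉p⇒x∈∁p; x∈p⇒x∉∁p; x∈p∧x≢y⇒x∈p-y; x∈p⇒∣p-x∣<∣p∣;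
         x∈⁅x⁆; x∈p∪q⁺)
open import Data.Vec using ([]; _∷_)
open import Data.Bool using (true; false)
open import Data.Product using (Σ; _×_; _,_)
open import Data.Sum using (inj₁; inj₂)
open import Function using (_∘_)
open import Relation.Nullary using (yes; no; contradiction)
open import Relation.Nullary.Decidable using (_×-dec_)
open import Relation.Binary.PropositionalEquality using (_≡_; _≢_; refl; sym; trans; cong; subst; subst₂)

private
  variable
    n ℓ : ℕ
    G : Graph n
    u v : Fin n

∣p∪q∣≤∣p∣+∣q∣ : (p q : Subset n) → ∣ p ∪ q ∣ ≤ ∣ p ∣ + ∣ q ∣
∣p∪q∣≤∣p∣+∣q∣ []          []          = z≤n
∣p∪q∣≤∣p∣+∣q∣ (true ∷ p)  (true ∷ q)  = s≤s (≤-trans (∣p∪q∣≤∣p∣+∣q∣ p q) (+-monoʳ-≤ ∣ p ∣ (n≤1+n ∣ q ∣)))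
∣p∪q∣≤∣p∣+∣q∣ (true ∷ p)  (false ∷ q) = s≤s (∣p∪q∣≤∣p∣+∣q∣ p q)
∣p∪q∣≤∣p∣+∣q∣ (false ∷ p) (true ∷ q)  = subst (∣ p ∪ q ∣ <_) (sym (+-suc ∣ p ∣ ∣ q ∣)) (s≤s (∣p∪q∣≤∣p∣+∣q∣ p q))
∣p∪q∣≤∣p∣+∣q∣ (false ∷ p) (false ∷ q) = ∣p∪q∣≤∣p∣+∣q∣ p q

image : (ℕ → Fin n) → ℕ → Subset n
image f zero    = ⊥
image f (suc m) = image f m ∪ ⁅ f m ⁆

∣image∣≤ : (f : ℕ → Fin n) (m : ℕ) → ∣ image f m ∣ ≤ m
∣image∣≤ {n} f zero    = ≤-reflexive (∣⊥∣≡0 n)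
∣image∣≤ f (suc m) = begin
  ∣ image f m ∪ ⁅ f m ⁆ ∣      ≤⟨ ∣p∪q∣≤∣p∣+∣q∣ (image f m) ⁅ f m ⁆ ⟩
  ∣ image f m ∣ + ∣ ⁅ f m ⁆ ∣  ≤⟨ +-mono-≤ (∣image∣≤ f m) (≤-reflexive (∣⁅x⁆∣≡1 (f m))) ⟩
  m + 1                        ≡⟨ +-comm m 1 ⟩
  suc m                        ∎
  where open ≤-Reasoning

∈-image : (f : ℕ → Fin n) {k m : ℕ} → k < m → f k ∈ image f m
∈-image f {k} {suc m} k<1+m with m≤n⇒m<n∨m≡n (s≤s⁻¹ k<1+m)
... | inj₁ k<m  = x∈p∪q⁺ (inj₁ (∈-image f k<m))
... | inj₂ refl = x∈p∪q⁺ (inj₂ (x∈⁅x⁆ (f k)))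

distinct-⊆⇒≤∣∣ : (f : ℕ → Fin n) (m : ℕ) (p : Subset n) →
  (∀ {a b} → a < b → b < m → f a ≢ f b) → (∀ {k} → k < m → f k ∈ p) → m ≤ ∣ p ∣
distinct-⊆⇒≤∣∣ f zero    p _        _   = z≤n
distinct-⊆⇒≤∣∣ f (suc m) p distinct mem =
  <-≤-trans (s≤s (distinct-⊆⇒≤∣∣ f m (p - f m) distinct′ mem′)) (x∈p⇒∣p-x∣<∣p∣ (mem (n<1+n m)))
  where
  distinct′ : ∀ {a b} → a < b → b < m → f a ≢ f b
  distinct′ a<b b<m = distinct a<b (m<n⇒m<1+n b<m)
  mem′ : ∀ {k} → k < m → f k ∈ p - f m
  mem′ k<m = x∈p∧x≢y⇒x∈p-y (mem (m<n⇒m<1+n k<m)) (distinct k<m (n<1+n m))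

-- Positions beyond ℓ are clamped to ℓ, so that a walk can be read as a sequence ℕ → Fin n.
clamp : ∀ ℓ → ℕ → Fin (suc ℓ)
clamp ℓ       zero    = Fin.zero
clamp zero    (suc k) = Fin.zero
clamp (suc ℓ) (suc k) = Fin.suc (clamp ℓ k)

toℕ-clamp : ∀ ℓ {k} → k ≤ ℓ → toℕ (clamp ℓ k) ≡ k
toℕ-clamp ℓ       {zero}  _         = refl
toℕ-clamp (suc ℓ) {suc k} (s≤s k≤ℓ) = cong suc (toℕ-clamp ℓ k≤ℓ)

clamp-toℕ : ∀ ℓ (i : Fin (suc ℓ)) → clamp ℓ (toℕ i) ≡ i
clamp-toℕ ℓ       Fin.zero    = refl
clamp-toℕ (suc ℓ) (Fin.suc i) = cong Fin.suc (clamp-toℕ ℓ i)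

vertexAt : Walk G u v ℓ → ℕ → Fin _
vertexAt {ℓ = ℓ} W k = vtx W (clamp ℓ k)

Steps : Graph n → (ℕ → Fin n) → ℕ → Set
Steps G f ℓ = ∀ k → k < ℓ → Adj G (f k) (f (suc k))

vertexAt-end : (W : Walk G u v ℓ) → vertexAt W ℓ ≡ v
vertexAt-end {ℓ = ℓ} W = trans (cong (vtx W) (toℕ-injective (trans (toℕ-clamp ℓ ≤-refl) (sym (toℕ-fromℕ ℓ))))) (end W)

vertexAt-steps : (W : Walk G u v ℓ) → Steps G (vertexAt W) ℓ
vertexAt-steps {G = G} {ℓ = ℓ} W k k<ℓ =
  subst₂ (λ i j → Adj G (vtx W i) (vtx W j)) inject₁-i≡ suc-i≡ (steps W i)
  where
  i = fromℕ< k<ℓ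
  inject₁-i≡ : inject₁ i ≡ clamp ℓ k
  inject₁-i≡ = toℕ-injective (trans (toℕ-inject₁ i) (trans (toℕ-fromℕ< k<ℓ) (sym (toℕ-clamp ℓ (<⇒≤ k<ℓ)))))
  suc-i≡ : Fin.suc i ≡ clamp ℓ (suc k)
  suc-i≡ = toℕ-injective (trans (cong suc (toℕ-fromℕ< k<ℓ)) (sym (toℕ-clamp ℓ k<ℓ)))

fromSteps : (f : ℕ → Fin n) → f 0 ≡ u → f ℓ ≡ v → Steps G f ℓ → Walk G u v ℓ
fromSteps {ℓ = ℓ} {G = G} f f0≡u fℓ≡v st = record
  { vtx   = f ∘ toℕ
  ; start = f0≡u
  ; end   = trans (cong f (toℕ-fromℕ ℓ)) fℓ≡v
  ; steps = λ i → subst (λ k → Adj G (f k) (f (suc (toℕ i)))) (sym (toℕ-inject₁ i)) (st (toℕ i) (toℕ<n i))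
  }

append : {A : Set} → ℕ → (ℕ → A) → (ℕ → A) → ℕ → A
append zero    f g k       = g k
append (suc a) f g zero    = f zero
append (suc a) f g (suc k) = append a (f ∘ suc) g k

append-+ : {A : Set} (a : ℕ) (f g : ℕ → A) (k : ℕ) → append a f g (a + k) ≡ g k
append-+ zero    f g k = refl
append-+ (suc a) f g k = append-+ a (f ∘ suc) g k

append-≤ : {A : Set} (a : ℕ) (f g : ℕ → A) → f a ≡ g 0 → ∀ {k} → k ≤ a → append a f g k ≡ f k
append-≤ zero    f g fa≡g0 z≤n     = sym fa≡g0
append-≤ (suc a) f g fa≡g0 {zero}  _         = refl
append-≤ (suc a) f g fa≡g0 {suc k} (s≤s k≤a) = append-≤ a (f ∘ suc) g fa≡g0 k≤a

append-steps : (a : ℕ) (f g : ℕ → Fin n) {b : ℕ} → f a ≡ g 0 →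
  Steps G f a → Steps G g b → Steps G (append a f g) (a + b)
append-steps zero    f g _     _  stg k       k<b       = stg k k<b
append-steps {G = G} (suc a) f g fa≡g0 stf stg zero    _ =
  subst (Adj G (f 0)) (sym (append-≤ a (f ∘ suc) g fa≡g0 z≤n)) (stf 0 (s≤s z≤n))
append-steps {G = G} (suc a) f g fa≡g0 stf stg (suc k) (s≤s k<a+b) =
  append-steps {G = G} a (f ∘ suc) g fa≡g0 (λ k k<a → stf (suc k) (s≤s k<a)) stg k k<a+b

shortestPath-length-unique : ∀ {ℓ′} → ShortestPath G u v ℓ → ShortestPath G u v ℓ′ → ℓ ≡ ℓ′
shortestPath-length-unique {ℓ = ℓ} {ℓ′} P Q = ≤-antisym (minimal P ℓ′ (walk Q)) (minimal Q ℓ (walk P))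

-- Otherwise cutting out the closed subwalk between positions i and j leaves a shorter u,v-walk.
shortestPath-distinct : (P : ShortestPath G u v ℓ) → ∀ {i j} → i < j → j ≤ ℓ →
  vertexAt (walk P) i ≢ vertexAt (walk P) j
shortestPath-distinct {G = G} {u} {v} {ℓ} P {i} {j} i<j j≤ℓ fi≡fj =
  <⇒≱ shorter (minimal P (i + r) shortcut)
  where
  W = walk P
  f = vertexAt W
  r = ℓ ∸ j
  g : ℕ → Fin _
  g k = f (k + j)
  r+j≡ℓ : r + j ≡ ℓ
  r+j≡ℓ = m∸n+n≡m j≤ℓ
  shortcut : Walk G u v (i + r)
  shortcut = fromSteps (append i f g)
    (trans (append-≤ i f g fi≡fj z≤n) (start W))
    (trans (append-+ i f g r) (trans (cong f r+j≡ℓ) (vertexAt-end W)))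
    (append-steps {G = G} i f g fi≡fj
      (λ k k<i → vertexAt-steps W k (<-trans k<i (<-≤-trans i<j j≤ℓ)))
      (λ k k<r → vertexAt-steps W (k + j) (subst (k + j <_) r+j≡ℓ (+-monoˡ-< j k<r))))
  shorter : i + r < ℓ
  shorter = subst (i + r <_) (trans (+-comm j r) r+j≡ℓ) (+-monoˡ-< r i<j)

internal⇒interior : {Q : Fin n → Set} (W : Walk G u v ℓ) →
  (∀ i → Internal ℓ i → Q (vtx W i)) → ∀ {k} → k < pred ℓ → Q (vertexAt W (suc k))
internal⇒interior {ℓ = suc ℓ} W all {k} k<ℓ =
  all (clamp (suc ℓ) (suc k)) (s≤s z≤n , s≤s (subst (_< ℓ) (sym (toℕ-clamp ℓ (<⇒≤ k<ℓ))) k<ℓ))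

interior⇒internal : {Q : Fin n → Set} (W : Walk G u v ℓ) →
  (∀ {k} → k < pred ℓ → Q (vertexAt W (suc k))) → ∀ i → Internal ℓ i → Q (vtx W i)
interior⇒internal {ℓ = suc ℓ} {Q = Q} W all (Fin.suc i) (_ , s≤s i<ℓ) =
  subst (Q ∘ vtx W) (cong Fin.suc (clamp-toℕ ℓ i)) (all i<ℓ)

shortestPath-interior-≤ : (P : ShortestPath G u v ℓ) (p : Subset n) →
  (∀ i → Internal ℓ i → vtx (walk P) i ∈ p) → pred ℓ ≤ ∣ p ∣
shortestPath-interior-≤ P p mem =
  distinct-⊆⇒≤∣∣ (vertexAt (walk P) ∘ suc) _ p
    (λ a<b b<ℓ-1 → shortestPath-distinct P (s≤s a<b) (<-≤-trans b<ℓ-1 pred[n]≤n))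
    (internal⇒interior {Q = _∈ p} (walk P) mem)

shortestPath-length< : {G : Graph n} → ShortestPath G u v ℓ → ℓ < n
shortestPath-length< {n} {ℓ = ℓ} P = subst (ℓ <_) (∣⊤∣≡n n)
  (distinct-⊆⇒≤∣∣ (vertexAt (walk P)) (suc ℓ) ⊤
    (λ a<b b<1+ℓ → shortestPath-distinct P a<b (s≤s⁻¹ b<1+ℓ)) (λ _ → ∈⊤))

≤∣∁p∣⇒∣p∣+≤n : ∀ {m} (p : Subset n) → m ≤ ∣ ∁ p ∣ → ∣ p ∣ + m ≤ n
≤∣∁p∣⇒∣p∣+≤n {n} {m} p m≤∣∁p∣ = begin
  ∣ p ∣ + m            ≤⟨ +-monoʳ-≤ ∣ p ∣ (subst (m ≤_) (∣∁p∣≡n∸∣p∣ p) m≤∣∁p∣) ⟩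
  ∣ p ∣ + (n ∸ ∣ p ∣)  ≡⟨ m+[n∸m]≡n (∣p∣≤n p) ⟩
  n                    ∎
  where open ≤-Reasoning

diametralPath-avoiding : ∀ {d} {G : Graph n} {X : Subset n} → IsDiam G d → IsTotalMutualVisibilitySet G X →
  Σ (Fin n) λ u → Σ (Fin n) λ v → Σ (ShortestPath G u v d) λ Y → ∀ i → Internal d i → vtx (walk Y) i ∉ X
diametralPath-avoiding {G = G} {X} ((u , v , D) , _) tmv with tmv u v
... | ℓ , Y , avoids = u , v , subst (λ ℓ → Σ (ShortestPath G u v ℓ) λ Y → ∀ i → Internal ℓ i → vtx (walk Y) i ∉ X)
                                   (shortestPath-length-unique Y D) (Y , avoids)

tmv-bound : ∀ {d} {G : Graph n} {X : Subset n} → IsDiam G d → IsTotalMutualVisibilitySet G X →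
  ∣ X ∣ + pred d ≤ n
tmv-bound {X = X} diam tmv with diametralPath-avoiding diam tmv
... | _ , _ , Y , avoids = ≤∣∁p∣⇒∣p∣+≤n X (shortestPath-interior-≤ Y (∁ X) (λ i int → x∉p⇒x∈∁p (avoids i int)))

diam-positive : ∀ {d} {G : Graph n} {X : Subset n} → 2 ≤ n → IsDiam G d → IsTotalMutualVisibilitySet G X → 1 ≤ d
diam-positive {suc (suc n)} (s≤s (s≤s z≤n)) (_ , diametral) tmv with tmv Fin.zero (Fin.suc Fin.zero)
... | zero  , Y , _ = contradiction (trans (sym (start (walk Y))) (end (walk Y))) λ ()
... | suc ℓ , Y , _ = ≤-trans (s≤s z≤n) (diametral _ _ (suc ℓ) Y)

-- If some vertex w ∉ X were off the interior of Y, the interior would avoid X ∪ {w} and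
-- the counting bound would give ∣ X ∣ + 1 + pred d ≤ n.
∉-on-interior : ∀ {d} {G : Graph n} {X : Subset n} (Y : ShortestPath G u v d) →
  (∀ i → Internal d i → vtx (walk Y) i ∉ X) → n ≤ ∣ X ∣ + pred d →
  ∀ w → w ∉ X → Σ (Fin (suc d)) λ i → Internal d i × vtx (walk Y) i ≡ w
∉-on-interior {n} {d = d} {X = X} Y avoids large w w∉X
  with any? (λ i → ((0 <? toℕ i) ×-dec (toℕ i <? d)) ×-dec (vtx (walk Y) i ≟ᶠ w))
... | yes on = on
... | no ¬on = contradiction large (<⇒≱ (subst (_≤ n) (+-suc ∣ X ∣ (pred d)) (≤∣∁p∣⇒∣p∣+≤n X pred-d<∣∁X∣)))
  where
  pred-d<∣∁X∣ : pred d < ∣ ∁ X ∣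
  pred-d<∣∁X∣ = ≤-<-trans
    (shortestPath-interior-≤ Y (∁ X - w)
      (λ i int → x∈p∧x≢y⇒x∈p-y (x∉p⇒x∈∁p (avoids i int)) (λ on → ¬on (i , int , on))))
    (x∈p⇒∣p-x∣<∣p∣ (x∉p⇒x∈∁p w∉X))

largeTMV⇒conditionII : ∀ {d} {G : Graph n} {X : Subset n} → IsDiam G d → IsTotalMutualVisibilitySet G X →
  n ≤ ∣ X ∣ + pred d → ConditionII G d
largeTMV⇒conditionII diam tmv large with diametralPath-avoiding diam tmv
... | u , v , Y , avoids = u , v , Y , λ u′ v′ →
  let ℓ , Z , avoidsZ = tmv u′ v′ in
  ℓ , Z , λ j int → let i , int′ , on = ∉-on-interior Y avoids large _ (avoidsZ j int) in i , int′ , sym on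

conditionII⇒largeTMV : ∀ {d} {G : Graph n} → ConditionII G d →
  Σ (Subset n) λ X → IsTotalMutualVisibilitySet G X × n ≤ ∣ X ∣ + pred d
conditionII⇒largeTMV {n} {d} (_ , _ , P , paths) = ∁ I , tmv , large
  where
  I = image (vertexAt (walk P) ∘ suc) (pred d)
  internal∈I : ∀ i → Internal d i → vtx (walk P) i ∈ I
  internal∈I = interior⇒internal {Q = _∈ I} (walk P) (∈-image _)
  tmv : IsTotalMutualVisibilitySet _ (∁ I)
  tmv u v =
    let ℓ , Y , via = paths u v in
    ℓ , Y , λ j int → let i , int′ , on = via j int in x∈p⇒x∉∁p (subst (_∈ I) (sym on) (internal∈I i int′))
  large : n ≤ ∣ ∁ I ∣ + pred d
  large = begin
    n                   ≡⟨ sym (m∸n+n≡m (∣p∣≤n I)) ⟩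
    n ∸ ∣ I ∣ + ∣ I ∣   ≤⟨ +-monoʳ-≤ (n ∸ ∣ I ∣) (∣image∣≤ _ (pred d)) ⟩
    n ∸ ∣ I ∣ + pred d  ≡⟨ cong (_+ pred d) (sym (∣∁p∣≡n∸∣p∣ I)) ⟩
    ∣ ∁ I ∣ + pred d    ∎
    where open ≤-Reasoning

n∸d+1+pred-d≡n : ∀ {n d} → 1 ≤ d → d ≤ n → n ∸ d + 1 + pred d ≡ n
n∸d+1+pred-d≡n {n} {suc d} _ d≤n = trans (+-assoc (n ∸ suc d) 1 d) (m∸n+n≡m d≤n)

proposition2p2 : ∀ {n} (G : Graph n) → 2 ≤ n → Connected G →
    ∀ (d : ℕ) → IsDiam G d →
    (IsMuT G (n ∸ d + 1) → ConditionII G d) × (ConditionII G d → IsMuT G (n ∸ d + 1))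
proposition2p2 {n} G 2≤n _ d diam@((_ , _ , D) , _) = i⇒ii , ii⇒i
  where
  μ+pred-d≡n : ∀ {X} → IsTotalMutualVisibilitySet G X → n ∸ d + 1 + pred d ≡ n
  μ+pred-d≡n tmv = n∸d+1+pred-d≡n (diam-positive 2≤n diam tmv) (<⇒≤ (shortestPath-length< D))

  i⇒ii : IsMuT G (n ∸ d + 1) → ConditionII G d
  i⇒ii ((X , tmv , ∣X∣≡μ) , _) =
    largeTMV⇒conditionII diam tmv (≤-reflexive (trans (sym (μ+pred-d≡n tmv)) (cong (_+ pred d) (sym ∣X∣≡μ))))

  ii⇒i : ConditionII G d → IsMuT G (n ∸ d + 1)
  ii⇒i cond with conditionII⇒largeTMV cond
  ... | X , tmv , large =
    (X , tmv , +-cancelʳ-≡ (pred d) _ _ (trans (≤-antisym (tmv-bound diam tmv) large) (sym (μ+pred-d≡n tmv)))) ,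
    λ X′ tmv′ → +-cancelʳ-≤ (pred d) _ _ (≤-trans (tmv-bound diam tmv′) (≤-reflexive (sym (μ+pred-d≡n tmv))))
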